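{- Let $k\ge 2$ be odd and $n\ge 1$. For every traversal string $t=t_1\cdots t_n$ of length $n$, with $a(t,1)=\prod_{j=1}^n t_j$ and $b(t,1)=k^n+1-\prod_{j=1}^n(k+1-t_j)$, the landing range length $b(t,1)-a(t,1)+1$ is odd.
   Context: A traversal string is a string $t=t_1\cdots t_n$ with $t_j\in\{1,\dots,k\}$; it indexes the vertex of layer $n+1$ of the infinite rooted directed $k$-ary tree reached from the root by taking the $t_j$-th leftmost child at step $j$. In labeled chip-firing starting with chips $1,\dots,k^n$ at the root, the chips that can end on that vertex form the integer interval $[a(t,1),b(t,1)]$ (the landing range); its length is $b(t,1)-a(t,1)+1$. -}

module Defs where

open import Data.Nat using (ℕ; suc; _+_; _∸_; _*_; _^_)
open import Data.Fin using (Fin; toℕ)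
open import Data.Vec using (Vec; []; _∷_)
open import Data.Integer as ℤ using (ℤ; +_)
open import Data.Product using (∃)
open import Relation.Binary.PropositionalEquality using (_≡_)

-- A traversal string of length n over {1,…,k}: entry i : Fin k stands for t_j = toℕ i + 1.
TraversalString : ℕ → ℕ → Set
TraversalString k n = Vec (Fin k) n

digit : {k : ℕ} → Fin k → ℕ
digit i = suc (toℕ i)

prodDigits : {k n : ℕ} → TraversalString k n → ℕ
prodDigits [] = 1
prodDigits (i ∷ t) = digit i * prodDigits t

prodComplDigits : {k n : ℕ} → TraversalString k n → ℕ
prodComplDigits [] = 1
prodComplDigits {k} (i ∷ t) = (k + 1 ∸ digit i) * prodComplDigits t

a₁ : {k n : ℕ} → TraversalString k n → ℤ
a₁ t = + prodDigits t

b₁ : {k n : ℕ} → TraversalString k n → ℤ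
b₁ {k} {n} t = (+ (k ^ n) ℤ.+ + 1) ℤ.- + prodComplDigits t

landingLength : {k n : ℕ} → TraversalString k n → ℤ
landingLength t = (b₁ t ℤ.- a₁ t) ℤ.+ + 1

OddNat : ℕ → Set
OddNat m = ∃ λ (j : ℕ) → m ≡ 2 * j + 1

OddInt : ℤ → Set
OddInt z = ∃ λ (m : ℤ) → z ≡ (+ 2) ℤ.* m ℤ.+ + 1

{-# OPTIONS --safe #-}
-- Since t + (k + 1 − t) = k + 1 is even when k is odd, each digit has the same parity as its
-- complement, so ∏ t_j and ∏ (k + 1 − t_j) have the same parity and their sum is even.
-- The landing range length k^n + 2 − (∏ t_j + ∏ (k + 1 − t_j)) is then odd, k^n being odd.
module Submission where

open import Defs
open import Data.Nat using (ℕ; _≥_; zero; suc; _+_; _*_; _∸_; _^_; parity)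
open import Data.Nat.Properties using (+-suc; m+[n∸m]≡n; m≤m+n; ≤-trans)
open import Data.Nat.Divisibility using (_∣_; divides; ∣-refl; ∣m∣n⇒∣m+n)
open import Data.Parity.Base as ℙ using (Parity; 0ℙ; 1ℙ)
open import Data.Parity.Properties using (+-homo-+; *-homo-*; p+p≡0ℙ; +-cancelʳ-≡)
open import Data.Fin using (Fin)
open import Data.Fin.Properties using (toℕ<n)
open import Data.Vec using ([]; _∷_)
open import Data.Integer as ℤ using (ℤ; +_)
open import Data.Integer.Properties using (pos-+; pos-*)
open import Data.Integer.Tactic.RingSolver using (solve-∀)
open import Data.Product using (_,_)
open import Relation.Binary.PropositionalEquality

odd⇒parity≡1ℙ : ∀ {m} → OddNat m → parity m ≡ 1ℙ
odd⇒parity≡1ℙ (j , refl) = begin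
  parity (2 * j + 1)                   ≡⟨ +-homo-+ (2 * j) 1 ⟩
  parity (2 * j) ℙ.+ 1ℙ                ≡⟨ cong (ℙ._+ 1ℙ) (*-homo-* 2 j) ⟩
  0ℙ ℙ.+ 1ℙ                            ∎
  where open ≡-Reasoning

parity≡1ℙ⇒odd : ∀ m → parity m ≡ 1ℙ → OddNat m
parity≡1ℙ⇒odd 1 _ = 0 , refl
parity≡1ℙ⇒odd (suc (suc m)) h with j , refl ← parity≡1ℙ⇒odd m h =
  suc j , cong (λ x → suc x + 1) (sym (+-suc j (j + 0)))

parity≡0ℙ⇒2∣ : ∀ m → parity m ≡ 0ℙ → 2 ∣ m
parity≡0ℙ⇒2∣ zero          _ = divides 0 refl
parity≡0ℙ⇒2∣ (suc (suc m)) h = ∣m∣n⇒∣m+n ∣-refl (parity≡0ℙ⇒2∣ m h)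

parity-^-odd : ∀ {m} → parity m ≡ 1ℙ → ∀ n → parity (m ^ n) ≡ 1ℙ
parity-^-odd _         zero    = refl
parity-^-odd {m} m-odd (suc n) = begin
  parity (m * m ^ n)                   ≡⟨ *-homo-* m (m ^ n) ⟩
  parity m ℙ.* parity (m ^ n)          ≡⟨ cong₂ ℙ._*_ m-odd (parity-^-odd m-odd n) ⟩
  1ℙ                                   ∎
  where open ≡-Reasoning

sum-parity≡0ℙ⇒≡ : ∀ (p q : Parity) → p ℙ.+ q ≡ 0ℙ → p ≡ q
sum-parity≡0ℙ⇒≡ p q h = +-cancelʳ-≡ q p q (trans h (sym (p+p≡0ℙ q)))

digit+complement≡k+1 : ∀ {k} (i : Fin k) → digit i + (k + 1 ∸ digit i) ≡ k + 1
digit+complement≡k+1 {k} i = m+[n∸m]≡n (≤-trans (toℕ<n i) (m≤m+n k 1))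

parity-digit≡parity-complement : ∀ {k} → parity (k + 1) ≡ 0ℙ → (i : Fin k) →
  parity (digit i) ≡ parity (k + 1 ∸ digit i)
parity-digit≡parity-complement {k} k+1-even i = sum-parity≡0ℙ⇒≡ _ _ (begin
  parity (digit i) ℙ.+ parity (k + 1 ∸ digit i)  ≡⟨ +-homo-+ (digit i) (k + 1 ∸ digit i) ⟨
  parity (digit i + (k + 1 ∸ digit i))           ≡⟨ cong parity (digit+complement≡k+1 i) ⟩
  parity (k + 1)                                 ≡⟨ k+1-even ⟩
  0ℙ                                             ∎)
  where open ≡-Reasoning

parity-prodDigits≡parity-prodComplDigits : ∀ {k n} → parity (k + 1) ≡ 0ℙ →
  (t : TraversalString k n) → parity (prodDigits t) ≡ parity (prodComplDigits t)
parity-prodDigits≡parity-prodComplDigits _        []      = refl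
parity-prodDigits≡parity-prodComplDigits {k} k+1-even (i ∷ t) = begin
  parity (digit i * prodDigits t)                        ≡⟨ *-homo-* (digit i) (prodDigits t) ⟩
  parity (digit i) ℙ.* parity (prodDigits t)             ≡⟨ cong₂ ℙ._*_
                                                              (parity-digit≡parity-complement k+1-even i)
                                                              (parity-prodDigits≡parity-prodComplDigits k+1-even t) ⟩
  parity (k + 1 ∸ digit i) ℙ.* parity (prodComplDigits t) ≡⟨ *-homo-* (k + 1 ∸ digit i) (prodComplDigits t) ⟨
  parity ((k + 1 ∸ digit i) * prodComplDigits t)         ∎
  where open ≡-Reasoning

2∣prodDigits+prodComplDigits : ∀ {k n} → parity (k + 1) ≡ 0ℙ →
  (t : TraversalString k n) → 2 ∣ prodDigits t + prodComplDigits t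
2∣prodDigits+prodComplDigits k+1-even t = parity≡0ℙ⇒2∣ _ (begin
  parity (P + Q)          ≡⟨ +-homo-+ P Q ⟩
  parity P ℙ.+ parity Q   ≡⟨ cong (ℙ._+ parity Q) (parity-prodDigits≡parity-prodComplDigits k+1-even t) ⟩
  parity Q ℙ.+ parity Q   ≡⟨ p+p≡0ℙ (parity Q) ⟩
  0ℙ                      ∎)
  where
  open ≡-Reasoning
  P = prodDigits t
  Q = prodComplDigits t

landingLength≡2+k^n-sum : ∀ {k n} (t : TraversalString k n) →
  landingLength t ≡ + (2 + k ^ n) ℤ.- + (prodDigits t + prodComplDigits t)
landingLength≡2+k^n-sum {k} {n} t = begin
  ((+ (k ^ n) ℤ.+ + 1) ℤ.- + Q ℤ.- + P) ℤ.+ + 1  ≡⟨ rearrange (+ (k ^ n)) (+ P) (+ Q) ⟩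
  (+ 2 ℤ.+ + (k ^ n)) ℤ.- (+ P ℤ.+ + Q)          ≡⟨ cong₂ ℤ._-_ (pos-+ 2 (k ^ n)) (pos-+ P Q) ⟨
  + (2 + k ^ n) ℤ.- + (P + Q)                    ∎
  where
  open ≡-Reasoning
  P = prodDigits t
  Q = prodComplDigits t
  rearrange : ∀ (K P Q : ℤ) → ((K ℤ.+ + 1) ℤ.- Q ℤ.- P) ℤ.+ + 1 ≡ (+ 2 ℤ.+ K) ℤ.- (P ℤ.+ Q)
  rearrange = solve-∀

odd-minus-even : ∀ {x y} → OddNat x → 2 ∣ y → OddInt (+ x ℤ.- + y)
odd-minus-even (j , refl) (divides q refl) = + j ℤ.- + q , (begin
  + (2 * j + 1) ℤ.- + (q * 2)            ≡⟨ cong₂ ℤ._-_ (pos-+ (2 * j) 1) (pos-* q 2) ⟩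
  (+ (2 * j) ℤ.+ + 1) ℤ.- + q ℤ.* + 2    ≡⟨ cong (λ x → (x ℤ.+ + 1) ℤ.- + q ℤ.* + 2) (pos-* 2 j) ⟩
  (+ 2 ℤ.* + j ℤ.+ + 1) ℤ.- + q ℤ.* + 2  ≡⟨ regroup (+ j) (+ q) ⟩
  + 2 ℤ.* (+ j ℤ.- + q) ℤ.+ + 1          ∎)
  where
  open ≡-Reasoning
  regroup : ∀ (j q : ℤ) → (+ 2 ℤ.* j ℤ.+ + 1) ℤ.- q ℤ.* + 2 ≡ + 2 ℤ.* (j ℤ.- q) ℤ.+ + 1
  regroup = solve-∀

proposition7p1 : (k n : ℕ) → OddNat k → k ≥ 2 → n ≥ 1 →
    (t : TraversalString k n) → OddInt (landingLength t)
proposition7p1 k n k-odd _ _ t =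
  subst OddInt (sym (landingLength≡2+k^n-sum t))
    (odd-minus-even 2+k^n-odd (2∣prodDigits+prodComplDigits k+1-even t))
  where
  parity-k≡1ℙ : parity k ≡ 1ℙ
  parity-k≡1ℙ = odd⇒parity≡1ℙ k-odd
  k+1-even : parity (k + 1) ≡ 0ℙ
  k+1-even = trans (+-homo-+ k 1) (cong (ℙ._+ 1ℙ) parity-k≡1ℙ)
  2+k^n-odd : OddNat (2 + k ^ n)
  2+k^n-odd = parity≡1ℙ⇒odd _ (parity-^-odd parity-k≡1ℙ n)
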